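{- For any positive integer $n$ and any integer $g \geq \frac{2}{3}n$, we have $PG(n,g) = p(n-g)$.
   Context: A partition $\lambda=(\lambda_1\ge\lambda_2\ge\cdots\ge\lambda_\ell)$ of a positive integer $n$ is a finite nonincreasing sequence of positive integers with sum $n$; $\ell(\lambda)$ is its number of parts, and $p(N)$ denotes the number of partitions of $N$ (with $p(0)=1$). For a cell $(i,j)$ of the Ferrers diagram of $\lambda$, the hook length $h_{(i,j)}(\lambda)$ is the number of cells consisting of the cell itself, the cells to its right in row $i$, and the cells below it in column $j$. A numerical set is a subset $S\subseteq\mathbb{N}_0=\{0,1,2,\dots\}$ containing $0$ with finite complement; it is a numerical semigroup if it is also closed under addition. To a partition $\lambda$ associate the numerical set $S_\lambda=\mathbb{N}_0\setminus\{h_{(i,1)}(\lambda): 1\le i\le \ell(\lambda)\}$ (the gaps of $S_\lambda$ are the hook lengths of the first column). $PG(n,g)$ denotes the number of partitions $\lambda$ of $n$ with exactly $g$ parts such that $S_\lambda$ is a numerical semigroup. -}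

module Defs where

open import Data.Nat using (ℕ; zero; suc; _+_; _*_; _∸_; _≤_; _≥_; _<_; _≤?_)
open import Data.List using (List; []; _∷_; length; drop; filter)
open import Data.Nat.ListAction using (sum)
open import Data.List.Relation.Unary.All using (All)
open import Data.List.Relation.Unary.Linked using (Linked)
open import Data.List.Relation.Unary.Unique.Propositional using (Unique)
open import Data.List.Membership.Propositional using (_∈_)
open import Data.Product using (Σ; ∃; _×_; _,_)
open import Function.Bundles using (_⇔_)
open import Relation.Binary.PropositionalEquality using (_≡_)
open import Relation.Nullary using (¬_)

IsPartitionOf : ℕ → List ℕ → Set
IsPartitionOf n la = All (λ x → 1 ≤ x) la × Linked _≥_ la × sum la ≡ n

numParts : List ℕ → ℕ
numParts = length

-- λ_i, 1-indexed (0 outside the range 1..ℓ)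
part : List ℕ → ℕ → ℕ
part []       _             = 0
part (x ∷ xs) zero          = 0
part (x ∷ xs) (suc zero)    = x
part (x ∷ xs) (suc (suc i)) = part xs (suc i)

arm : List ℕ → ℕ → ℕ → ℕ
arm la i j = part la i ∸ j

leg : List ℕ → ℕ → ℕ → ℕ
leg la i j = length (filter (j ≤?_) (drop i la))

hook : List ℕ → ℕ → ℕ → ℕ
hook la i j = suc (arm la i j + leg la i j)

IsGap : List ℕ → ℕ → Set
IsGap la a = ∃ λ i → 1 ≤ i × i ≤ numParts la × a ≡ hook la i 1

-- membership in S_λ = ℕ₀ \ {h_{(i,1)}(λ)}
_∈S_ : ℕ → List ℕ → Set
a ∈S la = ¬ IsGap la a

-- S_λ is a numerical semigroup.  (S_λ always contains 0 and has finite
-- complement, being a numerical set; the remaining condition is additive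
-- closure.)
IsNumericalSemigroupS : List ℕ → Set
IsNumericalSemigroupS la =
  (0 ∈S la) × (∀ a b → a ∈S la → b ∈S la → (a + b) ∈S la)

PGSet : ℕ → ℕ → List ℕ → Set
PGSet n g la = IsPartitionOf n la × numParts la ≡ g × IsNumericalSemigroupS la

HasCardinality : (List ℕ → Set) → ℕ → Set
HasCardinality P k =
  Σ (List (List ℕ)) λ L → Unique L × (∀ x → (x ∈ L) ⇔ P x) × length L ≡ k

PGis : ℕ → ℕ → ℕ → Set
PGis n g k = HasCardinality (PGSet n g) k

pIs : ℕ → ℕ → Set
pIs N k = HasCardinality (IsPartitionOf N) k

{-# OPTIONS --safe #-}
-- Adding a first column of height g to a partition μ of N = n − g gives a partition of n
-- with g parts, and every such partition arises from exactly one μ.  When 2n ≤ 3g, i.e.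
-- N + N ≤ g, each of them yields a numerical semigroup: since ℓ(μ) ≤ N, the rows of
-- length one make 1, …, g − ℓ(μ) gaps and no first-column hook exceeds N + g + 1 − ℓ(μ),
-- so two nonzero non-gaps add up to at least 2(g − ℓ(μ) + 1) ≥ N + g − ℓ(μ) + 2.
-- Hence PG(n, g) = p(N).
module Submission where

open import Defs
open import Data.Nat using (ℕ; zero; suc; pred; s≤s⁻¹; _+_; _*_; _∸_; _≤_; _<_; _≥_; _≤?_; _<?_; _≟_; z≤n; s≤s)
open import Data.Nat.Properties
open import Data.Nat.ListAction using (sum)
open import Data.Nat.Tactic.RingSolver using (solve-∀)
open import Algebra.Properties.CommutativeSemigroup +-commutativeSemigroup using (xy∙z≈xz∙y)
open import Data.List using (List; []; _∷_; length; map; replicate; filter; upTo; concatMap; deduplicate)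
open import Data.List.Properties using (length-map; length-drop; length-replicate; filter-all; ∷-injectiveˡ; ∷-injectiveʳ; ≡-dec)
open import Data.List.Relation.Unary.All as All using (All; []; _∷_; all?)
open import Data.List.Relation.Unary.All.Properties using (drop⁺; replicate⁺)
open import Data.List.Relation.Unary.AllPairs using (AllPairs; []; _∷_)
import Data.List.Relation.Unary.AllPairs.Properties as AllPairs
open import Data.List.Relation.Unary.Linked as Linked using (Linked; []; [-]; _∷_; linked?)
open import Data.List.Relation.Unary.Unique.Propositional using (Unique)
open import Data.List.Relation.Unary.Unique.DecPropositional.Properties using (deduplicate-!)
open import Data.List.Relation.Unary.Any as Any using (here; there)
open import Data.List.Membership.Propositional using (_∈_)
open import Data.List.Membership.Propositional.Properties
open import Data.Empty using (⊥-elim)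
open import Data.Product using (Σ; ∃; _×_; _,_; proj₁; proj₂)
open import Function.Bundles using (mk⇔; module Equivalence)
open import Relation.Binary.PropositionalEquality
open import Relation.Nullary using (¬_; yes; no)
open import Relation.Nullary.Decidable using (_×-dec_)
open import Relation.Unary using (Decidable)

Positive : List ℕ → Set
Positive = All (1 ≤_)

length≤sum : ∀ {xs} → Positive xs → length xs ≤ sum xs
length≤sum []       = z≤n
length≤sum (p ∷ ps) = +-mono-≤ p (length≤sum ps)

all≤sum : ∀ xs → All (_≤ sum xs) xs
all≤sum []       = []
all≤sum (x ∷ xs) =
  m≤m+n x (sum xs) ∷ All.map (λ y≤ → ≤-trans y≤ (m≤n+m (sum xs) x)) (all≤sum xs)

sum-replicate-1 : ∀ t → sum (replicate t 1) ≡ t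
sum-replicate-1 zero    = refl
sum-replicate-1 (suc t) = cong suc (sum-replicate-1 t)

replicate-linked : ∀ t → Linked _≥_ (replicate t 1)
replicate-linked zero          = []
replicate-linked (suc zero)    = [-]
replicate-linked (suc (suc t)) = ≤-refl ∷ replicate-linked (suc t)

unique-map : ∀ {A B : Set} {P : A → Set} (f : A → B) → (∀ {x y} → P x → P y → f x ≡ f y → x ≡ y) →
             ∀ {xs} → All P xs → Unique xs → Unique (map f xs)
unique-map {P = P} f inj ps u = AllPairs.map⁺ (distinct-images ps u)
  where
  distinct-images : ∀ {xs} → All P xs → Unique xs → AllPairs (λ x y → ¬ f x ≡ f y) xs
  distinct-images []        []        = []
  distinct-images (px ∷ ps) (x∉ ∷ u) =
    All.zipWith (λ (py , x≢y) fx≡fy → x≢y (inj px py fx≡fy)) (ps , x∉) ∷ distinct-images ps u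

HasCardinality-bijection : ∀ {P Q : List ℕ → Set} {k} (f : List ℕ → List ℕ) →
  (∀ {x y} → P x → P y → f x ≡ f y → x ≡ y) →
  (∀ {x} → P x → Q (f x)) →
  (∀ {y} → Q y → ∃ λ x → P x × f x ≡ y) →
  HasCardinality P k → HasCardinality Q k
HasCardinality-bijection {P} {Q} f inj P⇒Q Q⇒P (L , unique , L⇔P , length≡k) =
  map f L , unique-map f inj (All.tabulate (λ {x} → to (L⇔P x))) unique ,
  (λ y → mk⇔ (image⇒Q y) (Q⇒image y)) , trans (length-map f L) length≡k
  where
  open Equivalence
  image⇒Q : ∀ y → y ∈ map f L → Q y
  image⇒Q y y∈ with ∈-map⁻ f y∈
  ... | x , x∈L , refl = P⇒Q (to (L⇔P x) x∈L)
  Q⇒image : ∀ y → Q y → y ∈ map f L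
  Q⇒image y Qy with Q⇒P Qy
  ... | x , Px , refl = ∈-map⁺ f (from (L⇔P x) Px)

decidable⇒HasCardinality : ∀ {P : List ℕ → Set} → Decidable P → (L : List (List ℕ)) →
                           (∀ {x} → P x → x ∈ L) → ∃ (HasCardinality P)
decidable⇒HasCardinality {P} P? L P⊆L =
  length D , D , deduplicate-! (≡-dec _≟_) _ , (λ x → mk⇔ D⇒P (P⇒D x)) , refl
  where
  D : List (List ℕ)
  D = deduplicate (≡-dec _≟_) (filter P? L)
  D⇒P : ∀ {x} → x ∈ D → P x
  D⇒P x∈D = proj₂ (∈-filter⁻ P? {xs = L} (∈-deduplicate⁻ (≡-dec _≟_) (filter P? L) x∈D))
  P⇒D : ∀ x → P x → x ∈ D
  P⇒D x Px = ∈-deduplicate⁺ (≡-dec _≟_) (∈-filter⁺ P? (P⊆L Px) Px)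

boundedLists : ℕ → ℕ → List (List ℕ)
boundedLists B zero    = [] ∷ []
boundedLists B (suc k) = [] ∷ concatMap (λ x → map (x ∷_) (boundedLists B k)) (upTo (suc B))

∈-boundedLists : ∀ {B k xs} → All (_≤ B) xs → length xs ≤ k → xs ∈ boundedLists B k
∈-boundedLists {k = zero}  []       _         = here refl
∈-boundedLists {k = suc k} []       _         = here refl
∈-boundedLists {B} {suc k} {x ∷ xs} (x≤B ∷ ≤B) (s≤s ℓ≤k) =
  there (∈-concatMap⁺ (λ y → map (y ∷_) (boundedLists B k))
    (Any.map (λ { refl → ∈-map⁺ (x ∷_) (∈-boundedLists ≤B ℓ≤k) }) (∈-upTo⁺ (s≤s x≤B))))

isPartitionOf? : ∀ n → Decidable (IsPartitionOf n)
isPartitionOf? n la = all? (1 ≤?_) la ×-dec linked? (λ x y → y ≤? x) la ×-dec sum la ≟ n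

partitions-HasCardinality : ∀ n → ∃ (HasCardinality (IsPartitionOf n))
partitions-HasCardinality n = decidable⇒HasCardinality (isPartitionOf? n) (boundedLists n n) bounded
  where
  bounded : ∀ {la} → IsPartitionOf n la → la ∈ boundedLists n n
  bounded {la} (pos , _ , sum≡n) =
    subst (λ s → la ∈ boundedLists s s) sum≡n (∈-boundedLists (all≤sum la) (length≤sum pos))

part+length≤1+sum : ∀ {μ} i → Positive μ → part μ i + length μ ≤ suc (sum μ)
part+length≤1+sum i [] = z≤n
part+length≤1+sum {x ∷ μ} zero (p ∷ ps) = s≤s (≤-trans (length≤sum ps) (m≤n+m (sum μ) x))
part+length≤1+sum {x ∷ μ} (suc zero) (p ∷ ps) = begin
  x + suc (length μ)  ≡⟨ +-suc x (length μ) ⟩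
  suc (x + length μ)  ≤⟨ s≤s (+-monoʳ-≤ x (length≤sum ps)) ⟩
  suc (x + sum μ)     ∎
  where open ≤-Reasoning
part+length≤1+sum {x ∷ μ} (suc (suc i)) (p ∷ ps) = begin
  part μ (suc i) + suc (length μ)  ≡⟨ +-suc (part μ (suc i)) (length μ) ⟩
  suc (part μ (suc i) + length μ)  ≤⟨ s≤s (part+length≤1+sum (suc i) ps) ⟩
  suc (suc (sum μ))                ≤⟨ s≤s (+-monoˡ-≤ (sum μ) p) ⟩
  suc (x + sum μ)                  ∎
  where open ≤-Reasoning

part-beyondLength : ∀ μ {i} → length μ < i → part μ i ≡ 0
part-beyondLength []      _               = refl
part-beyondLength (x ∷ μ) {suc zero}    (s≤s ())
part-beyondLength (x ∷ μ) {suc (suc i)} (s≤s m<i) = part-beyondLength μ m<i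

leg-firstColumn : ∀ {la} i → Positive la → leg la i 1 ≡ length la ∸ i
leg-firstColumn {la} i pos =
  trans (cong length (filter-all (1 ≤?_) (drop⁺ i pos))) (length-drop i la)

-- Adds a first column of height g to μ (of height ℓ(μ) instead, when ℓ(μ) > g).
addColumn : ℕ → List ℕ → List ℕ
addColumn g []      = replicate g 1
addColumn g (x ∷ μ) = suc x ∷ addColumn (pred g) μ

length-addColumn : ∀ g μ → length μ ≤ g → length (addColumn g μ) ≡ g
length-addColumn g       []      _         = length-replicate g
length-addColumn (suc g) (x ∷ μ) (s≤s m≤g) = cong suc (length-addColumn g μ m≤g)

length≤length-addColumn : ∀ g μ → length μ ≤ length (addColumn g μ)
length≤length-addColumn g []      = z≤n
length≤length-addColumn g (x ∷ μ) = s≤s (length≤length-addColumn (pred g) μ)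

sum-addColumn : ∀ g μ → length μ ≤ g → sum (addColumn g μ) ≡ sum μ + g
sum-addColumn g       []      _         = sum-replicate-1 g
sum-addColumn (suc g) (x ∷ μ) (s≤s m≤g) = begin
  suc x + sum (addColumn g μ)  ≡⟨ cong (suc x +_) (sum-addColumn g μ m≤g) ⟩
  suc (x + (sum μ + g))        ≡⟨ cong suc (sym (+-assoc x (sum μ) g)) ⟩
  suc (x + sum μ + g)          ≡⟨ sym (+-suc (x + sum μ) g) ⟩
  x + sum μ + suc g            ∎
  where open ≡-Reasoning

addColumn-positive : ∀ g μ → Positive (addColumn g μ)
addColumn-positive g       []      = replicate⁺ g ≤-refl
addColumn-positive g       (x ∷ μ) = s≤s z≤n ∷ addColumn-positive (pred g) μ

addColumn-linked : ∀ g {μ} → Linked _≥_ μ → Linked _≥_ (addColumn g μ)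
addColumn-linked g             []        = replicate-linked g
addColumn-linked zero          [-]       = [-]
addColumn-linked (suc zero)    [-]       = [-]
addColumn-linked (suc (suc g)) [-]       = s≤s z≤n ∷ replicate-linked (suc g)
addColumn-linked g             (x≥y ∷ l) = s≤s x≥y ∷ addColumn-linked (pred g) l

addColumn-injective : ∀ g {μ ν} → Positive μ → Positive ν → addColumn g μ ≡ addColumn g ν → μ ≡ ν
addColumn-injective g       {[]}    {[]}    _           _           _  = refl
addColumn-injective zero    {[]}    {_ ∷ _} _           _           ()
addColumn-injective (suc g) {[]}    {_ ∷ _} _           (s≤s _ ∷ _) ()
addColumn-injective zero    {_ ∷ _} {[]}    _           _           ()
addColumn-injective (suc g) {_ ∷ _} {[]}    (s≤s _ ∷ _) _           ()
addColumn-injective g       {_ ∷ _} {_ ∷ _} (_ ∷ pμ)    (_ ∷ pν)    eq =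
  cong₂ _∷_ (suc-injective (∷-injectiveˡ eq)) (addColumn-injective (pred g) pμ pν (∷-injectiveʳ eq))

part-addColumn : ∀ {g} μ {i} → 1 ≤ i → i ≤ g → part (addColumn g μ) i ≡ suc (part μ i)
part-addColumn {suc g} []      {suc zero}    _ _         = refl
part-addColumn {suc g} []      {suc (suc i)} _ (s≤s i<g) = part-addColumn {g} [] (s≤s z≤n) i<g
part-addColumn {suc g} (x ∷ μ) {suc zero}    _ _         = refl
part-addColumn {suc g} (x ∷ μ) {suc (suc i)} _ (s≤s i<g) = part-addColumn μ (s≤s z≤n) i<g

hook-addColumn : ∀ {g} μ {i} → length μ ≤ g → 1 ≤ i → i ≤ g →
                 hook (addColumn g μ) i 1 + i ≡ suc (part μ i) + g
hook-addColumn {g} μ {i} m≤g 1≤i i≤g = begin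
  suc (part la i ∸ 1 + leg la i 1) + i  ≡⟨ cong₂ (λ p l → suc (p ∸ 1 + l) + i) (part-addColumn μ 1≤i i≤g) leg≡ ⟩
  suc (part μ i + (g ∸ i)) + i          ≡⟨ cong suc (+-assoc (part μ i) (g ∸ i) i) ⟩
  suc (part μ i + (g ∸ i + i))          ≡⟨ cong (λ k → suc (part μ i + k)) (m∸n+n≡m i≤g) ⟩
  suc (part μ i) + g                    ∎
  where
  open ≡-Reasoning
  la : List ℕ
  la = addColumn g μ
  leg≡ : leg la i 1 ≡ g ∸ i
  leg≡ = trans (leg-firstColumn i (addColumn-positive g μ)) (cong (_∸ i) (length-addColumn g μ m≤g))

addColumn-gap≤ : ∀ {g μ h} → Positive μ → length μ ≤ g → IsGap (addColumn g μ) h →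
                 h + length μ ≤ suc (sum μ + g)
addColumn-gap≤ {g} {μ} pos m≤g (i , 1≤i , i≤ℓ , refl) = +-cancelʳ-≤ i _ _ (begin
  h + m + i                  ≡⟨ xy∙z≈xz∙y h m i ⟩
  h + i + m                  ≡⟨ cong (_+ m) (hook-addColumn μ m≤g 1≤i i≤g) ⟩
  suc (part μ i) + g + m     ≡⟨ cong suc (xy∙z≈xz∙y (part μ i) g m) ⟩
  suc (part μ i + m) + g     ≤⟨ +-monoˡ-≤ g (s≤s (part+length≤1+sum i pos)) ⟩
  suc (suc (sum μ)) + g      ≡⟨ cong suc (+-comm 1 (sum μ + g)) ⟩
  suc (sum μ + g) + 1        ≤⟨ +-monoʳ-≤ (suc (sum μ + g)) 1≤i ⟩
  suc (sum μ + g) + i        ∎)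
  where
  open ≤-Reasoning
  m h : ℕ
  m = length μ
  h = hook (addColumn g μ) i 1
  i≤g : i ≤ g
  i≤g = subst (i ≤_) (length-addColumn g μ m≤g) i≤ℓ

addColumn-gap : ∀ {g a} μ → 1 ≤ a → length μ + a ≤ g → IsGap (addColumn g μ) a
addColumn-gap {g} {a} μ 1≤a m+a≤g =
  i , s≤s z≤n , subst (i ≤_) (sym (length-addColumn g μ m≤g)) i≤g , sym (+-cancelʳ-≡ i _ _ hook+i)
  where
  m : ℕ
  m = length μ
  m≤g : m ≤ g
  m≤g = m+n≤o⇒m≤o m m+a≤g
  a≤g : a ≤ g
  a≤g = m+n≤o⇒n≤o m m+a≤g
  i : ℕ
  i = suc (g ∸ a)
  m<i : m < i
  m<i = s≤s (m+n≤o⇒m≤o∸n m m+a≤g)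
  i≤g : i ≤ g
  i≤g = begin
    suc (g ∸ a)  ≡⟨ +-comm 1 (g ∸ a) ⟩
    g ∸ a + 1    ≤⟨ +-monoʳ-≤ (g ∸ a) 1≤a ⟩
    g ∸ a + a    ≡⟨ m∸n+n≡m a≤g ⟩
    g            ∎
    where open ≤-Reasoning
  hook+i : hook (addColumn g μ) i 1 + i ≡ a + i
  hook+i = begin
    hook (addColumn g μ) i 1 + i  ≡⟨ hook-addColumn μ m≤g (s≤s z≤n) i≤g ⟩
    suc (part μ i) + g            ≡⟨ cong (λ p → suc p + g) (part-beyondLength μ m<i) ⟩
    suc g                         ≡⟨ cong suc (sym (m+[n∸m]≡n a≤g)) ⟩
    suc (a + (g ∸ a))             ≡⟨ sym (+-suc a (g ∸ a)) ⟩
    a + i                         ∎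
    where open ≡-Reasoning

addColumn-isNumericalSemigroup : ∀ {g μ} → Positive μ → sum μ + length μ ≤ g →
                                 IsNumericalSemigroupS (addColumn g μ)
addColumn-isNumericalSemigroup {g} {μ} pos N+m≤g = 0∈S , closed
  where
  N m : ℕ
  N = sum μ
  m = length μ
  la : List ℕ
  la = addColumn g μ
  0∈S : 0 ∈S la
  0∈S (_ , _ , _ , ())
  large : ∀ {a} → a ∈S la → 1 ≤ a → g < m + a
  large {a} a∈S 1≤a with g <? m + a
  ... | yes g<m+a = g<m+a
  ... | no  g≮m+a = ⊥-elim (a∈S (addColumn-gap μ 1≤a (≮⇒≥ g≮m+a)))
  swap : ∀ m a b → (m + a) + (m + b) ≡ (a + b + m) + m
  swap = solve-∀
  regroup : ∀ N m g → suc (N + g) + m ≡ (N + m) + suc g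
  regroup = solve-∀
  closed : ∀ a b → a ∈S la → b ∈S la → (a + b) ∈S la
  closed zero    b       _   b∈S = b∈S
  closed a@(suc _) zero  a∈S _   = subst (_∈S la) (sym (+-identityʳ a)) a∈S
  closed a@(suc _) b@(suc _) a∈S b∈S gap = 1+n≰n (≤-trans (+-cancelʳ-≤ (suc g) (suc g) (N + m) (begin
    suc g + suc g     ≤⟨ +-mono-≤ (large a∈S (s≤s z≤n)) (large b∈S (s≤s z≤n)) ⟩
    (m + a) + (m + b) ≡⟨ swap m a b ⟩
    (a + b + m) + m   ≤⟨ +-monoˡ-≤ m (addColumn-gap≤ pos (m+n≤o⇒n≤o N N+m≤g) gap) ⟩
    suc (N + g) + m   ≡⟨ regroup N m g ⟩
    (N + m) + suc g   ∎)) N+m≤g)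
    where open ≤-Reasoning

addColumn-head< : ∀ g μ {x y xs} → Linked _≥_ (x ∷ xs) → addColumn g (y ∷ μ) ≡ xs → y < x
addColumn-head< _ _ (x>y ∷ _) refl = x>y
addColumn-head< _ _ [-]       ()

removeColumn : ∀ {la} → Positive la → Linked _≥_ la →
               ∃ λ μ → Positive μ × Linked _≥_ μ × addColumn (length la) μ ≡ la
removeColumn [] [] = [] , [] , [] , refl
removeColumn {x ∷ xs} (_ ∷ pos) lin with removeColumn pos (Linked.tail lin)
removeColumn {suc zero ∷ xs} _ lin | [] , _ , _ , eq =
  [] , [] , [] , cong (1 ∷_) eq
removeColumn {suc zero ∷ xs} _ lin | y ∷ μ , s≤s _ ∷ _ , _ , eq
  with addColumn-head< (length xs) μ lin eq
... | s≤s ()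
removeColumn {suc (suc x) ∷ xs} _ lin | [] , _ , _ , eq =
  suc x ∷ [] , s≤s z≤n ∷ [] , [-] , cong (suc (suc x) ∷_) eq
removeColumn {suc (suc x) ∷ xs} _ lin | y ∷ μ , pμ , lμ , eq =
  suc x ∷ y ∷ μ , s≤s z≤n ∷ pμ , s≤s⁻¹ (addColumn-head< (length xs) μ lin eq) ∷ lμ , cong (suc (suc x) ∷_) eq

addColumn-surjective : ∀ {n la} → IsPartitionOf n la →
                       ∃ λ μ → IsPartitionOf (n ∸ length la) μ × addColumn (length la) μ ≡ la
addColumn-surjective {n} {la} (pos , lin , sum≡n) with removeColumn pos lin
... | μ , pμ , lμ , eq = μ , (pμ , lμ , sumμ) , eq
  where
  ℓ : ℕ
  ℓ = length la
  μ≤ℓ : length μ ≤ ℓ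
  μ≤ℓ = subst (length μ ≤_) (cong length eq) (length≤length-addColumn ℓ μ)
  sumμ : sum μ ≡ n ∸ ℓ
  sumμ = begin
    sum μ                      ≡⟨ sym (m+n∸n≡m (sum μ) ℓ) ⟩
    sum μ + ℓ ∸ ℓ              ≡⟨ cong (_∸ ℓ) (sym (sum-addColumn ℓ μ μ≤ℓ)) ⟩
    sum (addColumn ℓ μ) ∸ ℓ    ≡⟨ cong (λ l → sum l ∸ ℓ) eq ⟩
    sum la ∸ ℓ                 ≡⟨ cong (_∸ ℓ) sum≡n ⟩
    n ∸ ℓ                      ∎
    where open ≡-Reasoning

addColumn-PGSet : ∀ {N g μ} → N + N ≤ g → IsPartitionOf N μ → PGSet (N + g) g (addColumn g μ)
addColumn-PGSet {g = g} {μ} 2N≤g (pos , lin , refl) =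
  (addColumn-positive g μ , addColumn-linked g lin , sum-addColumn g μ m≤g) ,
  length-addColumn g μ m≤g , addColumn-isNumericalSemigroup pos N+m≤g
  where
  N+m≤g : sum μ + length μ ≤ g
  N+m≤g = ≤-trans (+-monoʳ-≤ (sum μ) (length≤sum pos)) 2N≤g
  m≤g : length μ ≤ g
  m≤g = m+n≤o⇒n≤o (sum μ) N+m≤g

2n≤3g⇒2[n∸g]≤g : ∀ {n g} → g ≤ n → 2 * n ≤ 3 * g → (n ∸ g) + (n ∸ g) ≤ g
2n≤3g⇒2[n∸g]≤g {n} {g} g≤n 2n≤3g = +-cancelʳ-≤ (g + g) (N + N) g (begin
  N + N + (g + g)  ≡⟨ double N g ⟩
  2 * (N + g)      ≡⟨ cong (2 *_) (m∸n+n≡m g≤n) ⟩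
  2 * n            ≤⟨ 2n≤3g ⟩
  3 * g            ≡⟨ triple g ⟩
  g + (g + g)      ∎)
  where
  open ≤-Reasoning
  N : ℕ
  N = n ∸ g
  double : ∀ N g → N + N + (g + g) ≡ 2 * (N + g)
  double = solve-∀
  triple : ∀ g → 3 * g ≡ g + (g + g)
  triple = solve-∀

theorem3p1 : (n g : ℕ) → 1 ≤ n → 2 * n ≤ 3 * g → g ≤ n →
    Σ ℕ (λ k → PGis n g k × pIs (n ∸ g) k)
theorem3p1 n g _ 2n≤3g g≤n =
  k , HasCardinality-bijection (addColumn g) injective into onto p[N] , p[N]
  where
  N : ℕ
  N = n ∸ g
  k : ℕ
  k = proj₁ (partitions-HasCardinality N)
  p[N] : HasCardinality (IsPartitionOf N) k
  p[N] = proj₂ (partitions-HasCardinality N)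
  N+g≡n : N + g ≡ n
  N+g≡n = m∸n+n≡m g≤n
  2N≤g : N + N ≤ g
  2N≤g = 2n≤3g⇒2[n∸g]≤g g≤n 2n≤3g
  injective : ∀ {μ ν} → IsPartitionOf N μ → IsPartitionOf N ν → addColumn g μ ≡ addColumn g ν → μ ≡ ν
  injective (pμ , _) (pν , _) = addColumn-injective g pμ pν
  into : ∀ {μ} → IsPartitionOf N μ → PGSet n g (addColumn g μ)
  into {μ} Pμ = subst (λ n → PGSet n g (addColumn g μ)) N+g≡n (addColumn-PGSet 2N≤g Pμ)
  onto : ∀ {la} → PGSet n g la → ∃ λ μ → IsPartitionOf N μ × addColumn g μ ≡ la
  onto {la} (Pla , ℓ≡g , _) =
    subst (λ ℓ → ∃ λ μ → IsPartitionOf (n ∸ ℓ) μ × addColumn ℓ μ ≡ la) ℓ≡g (addColumn-surjective Pla)
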